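{- Let $s=(s_i)_{i\in I}$ be a sequence of nonzero complex numbers indexed by an integer interval $I$ such that, for some $a_1,a_2\in\mathbb{C}$, $s_is_{i+4}=a_1s_{i+1}s_{i+3}+a_2s_{i+2}^2$ for all $i$ with $[i,i+4]\subseteq I$. Then the matrix $s\times s$ has diamond rank at most $2$, i.e. all $3\times3$ diamond minors of $s\times s$ vanish.
   Context: $s\times t$ is the matrix indexed by $I\times J$ with entry $s_it_j$ at $(i,j)$. The diagonal with offset $c$ is $\{(i,j):i-j=c\}$, the anti-diagonal with offset $c$ is $\{(i,j):i+j=c\}$; they meet at $((c'+c'')/2,(c''-c')/2)$ when this is a position. For pairwise distinct integers $e'_1,\dots,e'_k$ and $e''_1,\dots,e''_k$ such that all meeting points are positions, the $k\times k$ diamond sub-matrix has $(p,q)$-entry the entry at the meeting point of diagonal $e'_p$ and anti-diagonal $e''_q$; its determinant is a diamond minor. The diamond rank is the smallest $r\ge0$ such that all $(r+1)\times(r+1)$ diamond minors vanish. -}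

module Defs where

open import Level using (Level; _⊔_)
open import Algebra.Bundles using (CommutativeRing)
open import Data.Nat using (ℕ; zero; suc)
open import Data.Integer using (ℤ; _≤_) renaming (+_ to ⁺_; _+_ to _+ℤ_; _-_ to _-ℤ_)
open import Data.Fin using (Fin; zero; suc)
open import Data.List using (List; []; _∷_; foldr)
open import Data.Product using (Σ; _×_; _,_; proj₁; proj₂; ∃)
open import Relation.Nullary using (¬_)
open import Relation.Binary.PropositionalEquality using (_≡_)
open import Function.Definitions using (Injective)

module _ {c ℓ : Level} (R : CommutativeRing c ℓ) where
  open CommutativeRing R hiding (zero)

  natCast : ℕ → Carrier
  natCast zero    = 0#
  natCast (suc n) = 1# + natCast n

  -- value at x of the monic polynomial  c₀ + c₁x + … + c_{n-1}x^{n-1} + xⁿ,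
  -- where cs = c₀ ∷ … ∷ c_{n-1} (Horner scheme)
  evalMonic : List Carrier → Carrier → Carrier
  evalMonic cs x = foldr (λ a acc → a + x * acc) 1# cs

  -- The ring is an algebraically closed field of characteristic 0
  -- (the first-order theory of ℂ).
  record IsACF₀ : Set (c ⊔ ℓ) where
    field
      nontrivial  : ¬ (1# ≈ 0#)
      inverse     : ∀ x → ¬ (x ≈ 0#) → Σ Carrier (λ y → x * y ≈ 1#)
      charZero    : ∀ n → ¬ (natCast (suc n) ≈ 0#)
      algClosed   : ∀ (a : Carrier) (cs : List Carrier) →
                    Σ Carrier (λ x → evalMonic (a ∷ cs) x ≈ 0#)

  det3 : (Fin 3 → Fin 3 → Carrier) → Carrier
  det3 M =
      (m 0 0 * m 1 1 * m 2 2 + m 0 1 * m 1 2 * m 2 0 + m 0 2 * m 1 0 * m 2 1)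
    - (m 0 2 * m 1 1 * m 2 0 + m 0 0 * m 1 2 * m 2 1 + m 0 1 * m 1 0 * m 2 2)
    where
      f : ℕ → Fin 3
      f 0 = zero
      f 1 = suc zero
      f _ = suc (suc zero)
      m : ℕ → ℕ → Carrier
      m p q = M (f p) (f q)

  IsIntInterval : (ℤ → Set) → Set
  IsIntInterval I = ∀ {i j k} → i ≤ j → j ≤ k → I i → I k → I j

  SatisfiesRecurrence : (I : ℤ → Set) (s : ℤ → Carrier) (a₁ a₂ : Carrier) → Set ℓ
  SatisfiesRecurrence I s a₁ a₂ =
    ∀ i → (∀ j → i ≤ j → j ≤ i +ℤ ⁺ 4 → I j) →
      s i * s (i +ℤ ⁺ 4) ≈ a₁ * (s (i +ℤ ⁺ 1) * s (i +ℤ ⁺ 3)) + a₂ * (s (i +ℤ ⁺ 2) * s (i +ℤ ⁺ 2))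

  IsMeetingPosition : (I : ℤ → Set) → ℤ → ℤ → ℤ × ℤ → Set
  IsMeetingPosition I d e (i , j) = (i -ℤ j ≡ d) × (i +ℤ j ≡ e) × I i × I j

  outer : (s t : ℤ → Carrier) → ℤ × ℤ → Carrier
  outer s t (i , j) = s i * t j

  DiamondRankAtMost2 : (I : ℤ → Set) (s t : ℤ → Carrier) → Set ℓ
  DiamondRankAtMost2 I s t =
    ∀ (e′ e″ : Fin 3 → ℤ) → Injective _≡_ _≡_ e′ → Injective _≡_ _≡_ e″ →
    ∀ (pos : Fin 3 → Fin 3 → ℤ × ℤ) →
    (∀ p q → IsMeetingPosition I (e′ p) (e″ q) (pos p q)) →
    det3 (λ p q → outer s t (pos p q)) ≈ 0#

-- Write a diamond entry as s (m + t + r) · s (m − r): m indexes the anti-diagonal, r the diagonal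
-- and t ∈ {0, 1} is the common parity of all offsets.  For fixed t the rows
-- G k m = s (m + t + k) · s (m − k) satisfy G (k + 2) m · G k m = G (k + 1) (m + 1) · G (k + 1) (m − 1),
-- and the products of the shifted base rows G 1, G 0 are quadratic forms in (G 1 m , G 0 m) with
-- constant coefficients: this uses the recurrence and the conserved quantity
-- J = (s(m+2) s(m−1)² + s(m+1)² s(m−2) + a₁ s(m)³) / (s(m+1) s(m) s(m−1)) of the sequence.
-- By induction on k every row is then a fixed linear combination of G 1 and G 0: the quadratic form
-- for G (k + 1) (m + 1) · G (k + 1) (m − 1) is divisible by the linear form of G k because it
-- vanishes at its root, and a symmetry of the forms passes this divisibility on to the next pair.

module Submission where

open import Defs
open import Level using (Level; _⊔_)
open import Algebra.Bundles using (CommutativeRing)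
open import Algebra.Solver.Ring.AlmostCommutativeRing using (_-Raw-AlmostCommutative⟶_; fromCommutativeRing)
open import Data.Fin using (Fin; #_)
open import Data.Integer as ℤ using (ℤ; +_; -[1+_]; 1ℤ; sign; ∣_∣; _◃_; _⊖_)
open import Data.Integer.DivMod using (_%ℕ_; _/ℕ_; n%ℕd<d; a≡a%ℕn+[a/ℕn]*n)
import Data.Integer.Properties as ℤ
import Data.Integer.Tactic.RingSolver as ℤ-Solver
open import Data.Maybe using (Maybe; just; nothing)
open import Data.Nat as ℕ using (ℕ; zero; suc)
import Data.Nat.Properties as ℕ
open import Data.Product using (Σ; _×_; _,_; proj₁; proj₂; map₂)
open import Data.Sign as Sign using (Sign)
open import Function using (_∘_)
open import Relation.Nullary using (¬_; yes; no)
open import Relation.Nullary.Decidable using (True; toWitness)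
import Relation.Binary.PropositionalEquality as ≡

module _ {c ℓ} (R : CommutativeRing c ℓ) where
  open CommutativeRing R
  open import Relation.Binary.Reasoning.Setoid setoid

  Inverses : Set (c ⊔ ℓ)
  Inverses = ∀ x → ¬ x ≈ 0# → Σ Carrier λ y → x * y ≈ 1#

  -- Tactic.RingSolver takes its coefficients from the ring itself and so cannot see that 1# - 1#
  -- vanishes in an abstract ring; Algebra.Solver.Ring with coefficients in ℤ can.
  module IntegerCoefficients where
    open import Algebra.Properties.Semiring.Mult.TCOptimised semiring using (×1-homo-*) renaming (_×_ to _·_)
    open import Algebra.Properties.Monoid.Mult.TCOptimised +-monoid using (×-homo-+; 1+×)
    open import Algebra.Properties.Ring ring using (-‿involutive; -‿distribˡ-*; -‿distribʳ-*; -0#≈0#)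
    open import Algebra.Properties.AbelianGroup +-abelianGroup using (⁻¹-∙-comm)
    open import Algebra.Properties.CommutativeSemigroup +-commutativeSemigroup using (interchange)

    signed : Sign → Carrier → Carrier
    signed Sign.+ x = x
    signed Sign.- x = - x

    -- The optimised _·_ makes ⟦ + 1 ⟧ℤ reduce to 1#, so con (+ 1) stands for 1# in solver calls.
    ⟦_⟧ℤ : ℤ → Carrier
    ⟦ i ⟧ℤ = signed (sign i) (∣ i ∣ · 1#)

    ⟦◃⟧ : ∀ s n → ⟦ s ◃ n ⟧ℤ ≈ signed s (n · 1#)
    ⟦◃⟧ Sign.+ zero    = refl
    ⟦◃⟧ Sign.- zero    = sym -0#≈0#
    ⟦◃⟧ Sign.+ (suc n) = refl
    ⟦◃⟧ Sign.- (suc n) = refl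

    signed-cong : ∀ s {x y} → x ≈ y → signed s x ≈ signed s y
    signed-cong Sign.+ x≈y = x≈y
    signed-cong Sign.- x≈y = -‿cong x≈y

    signed-* : ∀ s t x y → signed (s Sign.* t) (x * y) ≈ signed s x * signed t y
    signed-* Sign.+ Sign.+ x y = refl
    signed-* Sign.+ Sign.- x y = -‿distribʳ-* x y
    signed-* Sign.- Sign.+ x y = -‿distribˡ-* x y
    signed-* Sign.- Sign.- x y = begin
      x * y         ≈⟨ -‿involutive (x * y) ⟨
      - - (x * y)   ≈⟨ -‿cong (-‿distribˡ-* x y) ⟩
      - (- x * y)   ≈⟨ -‿distribʳ-* (- x) y ⟩
      - x * - y     ∎

    ⟦⊖⟧ : ∀ m n → ⟦ m ⊖ n ⟧ℤ ≈ m · 1# - n · 1#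
    ⟦⊖⟧ m       zero    = sym (trans (+-congˡ -0#≈0#) (+-identityʳ _))
    ⟦⊖⟧ zero    (suc n) = sym (+-identityˡ _)
    ⟦⊖⟧ (suc m) (suc n) = begin
      ⟦ suc m ⊖ suc n ⟧ℤ                ≡⟨ ≡.cong ⟦_⟧ℤ (ℤ.[1+m]⊖[1+n]≡m⊖n m n) ⟩
      ⟦ m ⊖ n ⟧ℤ                        ≈⟨ ⟦⊖⟧ m n ⟩
      m · 1# - n · 1#                   ≈⟨ +-identityˡ _ ⟨
      0# + (m · 1# - n · 1#)            ≈⟨ +-congʳ (-‿inverseʳ 1#) ⟨
      (1# - 1#) + (m · 1# - n · 1#)     ≈⟨ interchange 1# (- 1#) (m · 1#) (- (n · 1#)) ⟩
      (1# + m · 1#) + (- 1# - n · 1#)   ≈⟨ +-congˡ (⁻¹-∙-comm 1# (n · 1#)) ⟩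
      (1# + m · 1#) - (1# + n · 1#)     ≈⟨ +-cong (1+× m 1#) (-‿cong (1+× n 1#)) ⟨
      suc m · 1# - suc n · 1#           ∎

    ⟦⟧-+ : ∀ i j → ⟦ i ℤ.+ j ⟧ℤ ≈ ⟦ i ⟧ℤ + ⟦ j ⟧ℤ
    ⟦⟧-+ (+ m)    (+ n)    = ×-homo-+ 1# m n
    ⟦⟧-+ (+ m)    -[1+ n ] = ⟦⊖⟧ m (suc n)
    ⟦⟧-+ -[1+ m ] (+ n)    = trans (⟦⊖⟧ n (suc m)) (+-comm _ _)
    ⟦⟧-+ -[1+ m ] -[1+ n ] = begin
      - (suc (suc (m ℕ.+ n)) · 1#)      ≡⟨ ≡.cong (λ k → - (suc k · 1#)) (ℕ.+-suc m n) ⟨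
      - ((suc m ℕ.+ suc n) · 1#)        ≈⟨ -‿cong (×-homo-+ 1# (suc m) (suc n)) ⟩
      - (suc m · 1# + suc n · 1#)       ≈⟨ ⁻¹-∙-comm _ _ ⟨
      - (suc m · 1#) - suc n · 1#       ∎

    ⟦⟧-* : ∀ i j → ⟦ i ℤ.* j ⟧ℤ ≈ ⟦ i ⟧ℤ * ⟦ j ⟧ℤ
    ⟦⟧-* i j = begin
      ⟦ sign i Sign.* sign j ◃ ∣ i ∣ ℕ.* ∣ j ∣ ⟧ℤ
        ≈⟨ ⟦◃⟧ (sign i Sign.* sign j) (∣ i ∣ ℕ.* ∣ j ∣) ⟩
      signed (sign i Sign.* sign j) ((∣ i ∣ ℕ.* ∣ j ∣) · 1#)
        ≈⟨ signed-cong (sign i Sign.* sign j) (×1-homo-* ∣ i ∣ ∣ j ∣) ⟩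
      signed (sign i Sign.* sign j) ((∣ i ∣ · 1#) * (∣ j ∣ · 1#))
        ≈⟨ signed-* (sign i) (sign j) _ _ ⟩
      ⟦ i ⟧ℤ * ⟦ j ⟧ℤ ∎

    ⟦⟧-neg : ∀ i → ⟦ ℤ.- i ⟧ℤ ≈ - ⟦ i ⟧ℤ
    ⟦⟧-neg (+ zero)  = sym -0#≈0#
    ⟦⟧-neg (+ suc n) = refl
    ⟦⟧-neg -[1+ n ]  = sym (-‿involutive _)

    homomorphism : ℤ.+-*-rawRing -Raw-AlmostCommutative⟶ fromCommutativeRing R
    homomorphism = record
      { ⟦_⟧    = ⟦_⟧ℤ
      ; +-homo = ⟦⟧-+
      ; *-homo = ⟦⟧-*
      ; -‿homo = ⟦⟧-neg
      ; 0-homo = refl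
      ; 1-homo = refl
      }

    ≟-coefficients : ∀ i j → Maybe (⟦ i ⟧ℤ ≈ ⟦ j ⟧ℤ)
    ≟-coefficients i j with i ℤ.≟ j
    ... | yes ≡.refl = just refl
    ... | no _       = nothing

    open import Algebra.Solver.Ring ℤ.+-*-rawRing (fromCommutativeRing R) homomorphism ≟-coefficients public
      using (solve; _:=_; _:+_; _:*_; _:-_; :-_; con)

  open IntegerCoefficients

  module LinearCombination where

    private
      difference≈0 : ∀ {P Q} → P ≈ Q → P - Q ≈ 0#
      difference≈0 {P} {Q} P≈Q = trans (+-congʳ P≈Q) (-‿inverseʳ Q)

      ≈-from-difference : ∀ {A B} → A - B ≈ 0# → A ≈ B
      ≈-from-difference {A} {B} A-B≈0 = begin
        A              ≈⟨ solve 2 (λ A B → A := (A :- B) :+ B) refl A B ⟩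
        (A - B) + B    ≈⟨ +-congʳ A-B≈0 ⟩
        0# + B         ≈⟨ +-identityˡ B ⟩
        B              ∎

      vanishing : ∀ {P Q} c → P ≈ Q → c * (P - Q) ≈ 0#
      vanishing c P≈Q = trans (*-congˡ (difference≈0 P≈Q)) (zeroʳ c)

    combination₁ : ∀ {A B P Q} c → A - B ≈ c * (P - Q) → P ≈ Q → A ≈ B
    combination₁ c A-B h = ≈-from-difference (trans A-B (vanishing c h))

    combination₂ : ∀ {A B P₁ Q₁ P₂ Q₂} c₁ c₂ → A - B ≈ c₁ * (P₁ - Q₁) + c₂ * (P₂ - Q₂) →
                   P₁ ≈ Q₁ → P₂ ≈ Q₂ → A ≈ B
    combination₂ c₁ c₂ A-B h₁ h₂ =
      ≈-from-difference (trans A-B (trans (+-cong (vanishing c₁ h₁) (vanishing c₂ h₂)) (+-identityʳ 0#)))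

    combination₃ : ∀ {A B P₁ Q₁ P₂ Q₂ P₃ Q₃} c₁ c₂ c₃ →
                   A - B ≈ c₁ * (P₁ - Q₁) + c₂ * (P₂ - Q₂) + c₃ * (P₃ - Q₃) →
                   P₁ ≈ Q₁ → P₂ ≈ Q₂ → P₃ ≈ Q₃ → A ≈ B
    combination₃ c₁ c₂ c₃ A-B h₁ h₂ h₃ = ≈-from-difference (trans A-B (trans
      (+-cong (trans (+-cong (vanishing c₁ h₁) (vanishing c₂ h₂)) (+-identityʳ 0#)) (vanishing c₃ h₃))
      (+-identityʳ 0#)))

  module Cancellation (inverse : Inverses) where

    *-cancelˡ-nonzero : ∀ {z x y} → ¬ z ≈ 0# → z * x ≈ z * y → x ≈ y
    *-cancelˡ-nonzero {z} {x} {y} z≉0 zx≈zy = begin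
      x              ≈⟨ *-identityʳ x ⟨
      x * 1#         ≈⟨ *-congˡ zw≈1 ⟨
      x * (z * w)    ≈⟨ regroup x ⟩
      w * (z * x)    ≈⟨ *-congˡ zx≈zy ⟩
      w * (z * y)    ≈⟨ regroup y ⟨
      y * (z * w)    ≈⟨ *-congˡ zw≈1 ⟩
      y * 1#         ≈⟨ *-identityʳ y ⟩
      y              ∎
      where
      w : Carrier
      w = proj₁ (inverse z z≉0)
      zw≈1 : z * w ≈ 1#
      zw≈1 = proj₂ (inverse z z≉0)
      regroup : ∀ a → a * (z * w) ≈ w * (z * a)
      regroup = solve 3 (λ z w a → a :* (z :* w) := w :* (z :* a)) refl z w

    *-nonzero : ∀ {x y} → ¬ x ≈ 0# → ¬ y ≈ 0# → ¬ x * y ≈ 0#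
    *-nonzero {x} x≉0 y≉0 xy≈0 = y≉0 (*-cancelˡ-nonzero x≉0 (trans xy≈0 (sym (zeroʳ x))))

  module BinaryForms where

    Linear : Set c
    Linear = Carrier × Carrier

    ⟨_⟩ : Linear → Carrier → Carrier → Carrier
    ⟨ a , b ⟩ x y = a * x + b * y

    record Quadratic : Set c where
      constructor quadratic
      field xx xy yy : Carrier

    ⟪_⟫ : Quadratic → Carrier → Carrier → Carrier
    ⟪ quadratic n₂ n₁ n₀ ⟫ x y = n₂ * (x * x) + n₁ * (x * y) + n₀ * (y * y)

    _atRootOf_ : Quadratic → Linear → Carrier
    N atRootOf (a , b) = ⟪ N ⟫ b (- a)

    first-coordinate : ∀ x y → x ≈ ⟨ 1# , 0# ⟩ x y
    first-coordinate = solve 2 (λ x y → x := con (+ 1) :* x :+ con (+ 0) :* y) refl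

    second-coordinate : ∀ x y → y ≈ ⟨ 0# , 1# ⟩ x y
    second-coordinate = solve 2 (λ x y → y := con (+ 0) :* x :+ con (+ 1) :* y) refl

    linear-vanishes-at-root : ∀ L → ⟨ L ⟩ (proj₂ L) (- proj₁ L) ≈ 0#
    linear-vanishes-at-root (a , b) = solve 2 (λ a b → a :* b :+ b :* (:- a) := con (+ 0)) refl a b

    -- The coefficients come from differentiating N = L · P at (x₀ , y₀), where L takes a value v with v * w ≈ 1#.
    quotient : Quadratic → Linear → (x₀ y₀ w : Carrier) → Linear
    quotient N@(quadratic n₂ n₁ n₀) L@(a , b) x₀ y₀ w = (p * (w * w) , q * (w * w))
      where
      p q : Carrier
      p = (n₂ * x₀ + n₂ * x₀ + n₁ * y₀) * ⟨ L ⟩ x₀ y₀ - a * ⟪ N ⟫ x₀ y₀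
      q = (n₁ * x₀ + n₀ * y₀ + n₀ * y₀) * ⟨ L ⟩ x₀ y₀ - b * ⟪ N ⟫ x₀ y₀

    unit-rescale : ∀ {v w x y} → v * w ≈ 1# → x * (v * v) ≈ y → x ≈ y * (w * w)
    unit-rescale {v} {w} {x} {y} vw≈1 xvv≈y = begin
      x                          ≈⟨ solve 1 (λ x → x := x :* (con (+ 1) :* con (+ 1))) refl x ⟩
      x * (1# * 1#)              ≈⟨ *-congˡ (*-cong vw≈1 vw≈1) ⟨
      x * ((v * w) * (v * w))    ≈⟨ solve 3 (λ v w x → x :* ((v :* w) :* (v :* w)) := x :* (v :* v) :* (w :* w)) refl v w x ⟩
      x * (v * v) * (w * w)      ≈⟨ *-congʳ xvv≈y ⟩
      y * (w * w)                ∎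

    factor-through-root : ∀ N L {x₀ y₀ w} → N atRootOf L ≈ 0# → ⟨ L ⟩ x₀ y₀ * w ≈ 1# →
                          ∀ x y → ⟪ N ⟫ x y ≈ ⟨ L ⟩ x y * ⟨ quotient N L x₀ y₀ w ⟩ x y
    factor-through-root N@(quadratic n₂ n₁ n₀) L@(a , b) {x₀} {y₀} {w} root vw≈1 x y =
      trans (unit-rescale vw≈1 (begin
        ⟪ N ⟫ x y * (v * v)                               ≈⟨ division ⟩
        ⟨ L ⟩ x y * ⟨ p , q ⟩ x y + e * e * N atRootOf L   ≈⟨ +-congˡ (trans (*-congˡ root) (zeroʳ _)) ⟩
        ⟨ L ⟩ x y * ⟨ p , q ⟩ x y + 0#                     ≈⟨ +-identityʳ _ ⟩
        ⟨ L ⟩ x y * ⟨ p , q ⟩ x y                          ∎))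
      (solve 7 (λ a b p q x y s → (a :* x :+ b :* y) :* (p :* x :+ q :* y) :* s
                                  := (a :* x :+ b :* y) :* (p :* s :* x :+ q :* s :* y))
               refl a b p q x y (w * w))
      where
      v p q e : Carrier
      v = ⟨ L ⟩ x₀ y₀
      p = (n₂ * x₀ + n₂ * x₀ + n₁ * y₀) * v - a * ⟪ N ⟫ x₀ y₀
      q = (n₁ * x₀ + n₀ * y₀ + n₀ * y₀) * v - b * ⟪ N ⟫ x₀ y₀
      e = x₀ * y - y₀ * x
      division : ⟪ N ⟫ x y * (v * v) ≈ ⟨ L ⟩ x y * ⟨ p , q ⟩ x y + e * e * N atRootOf L
      division = solve 9 (λ n₂ n₁ n₀ a b x₀ y₀ x y →
        let N′ = λ X Y → n₂ :* (X :* X) :+ n₁ :* (X :* Y) :+ n₀ :* (Y :* Y)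
            v′ = a :* x₀ :+ b :* y₀
            e′ = x₀ :* y :- y₀ :* x
        in  N′ x y :* (v′ :* v′)
            := (a :* x :+ b :* y) :* (((n₂ :* x₀ :+ n₂ :* x₀ :+ n₁ :* y₀) :* v′ :- a :* N′ x₀ y₀) :* x
                                     :+ ((n₁ :* x₀ :+ n₀ :* y₀ :+ n₀ :* y₀) :* v′ :- b :* N′ x₀ y₀) :* y)
               :+ e′ :* e′ :* N′ b (:- a))
        refl n₂ n₁ n₀ a b x₀ y₀ x y

  open BinaryForms

  module RowsInSpan where

    Row : (G : ℕ → ℤ → Carrier) (D : ℕ → ℤ → Set) → ℕ → Linear → Set ℓ
    Row G D k L = ∀ {m} → D k m → G k m ≈ ⟨ L ⟩ (G 1 m) (G 0 m)

    -- The form of L (m + 1) · L (m − 1) in (G 1 m , G 0 m) when the three products of shifted base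
    -- rows are the forms (u , v , 0), (− v , j , e), (0 , − e , d) of Family below; these shapes are
    -- exactly the ones for which shiftForm-symmetric holds.
    shiftForm : (u v j e d : Carrier) → Linear → Quadratic
    shiftForm u v j e d (a , b) =
      quadratic (b * b * u - a * b * v) (b * b * v + a * b * j - a * a * e) (a * b * e + a * a * d)

    shiftForm-symmetric : ∀ u v j e d L L′ → shiftForm u v j e d L atRootOf L′ ≈ shiftForm u v j e d L′ atRootOf L
    shiftForm-symmetric u v j e d (a , b) (a′ , b′) = solve 9 (λ u v j e d a b a′ b′ →
      let N = λ a b x y → (b :* b :* u :- a :* b :* v) :* (x :* x)
                          :+ (b :* b :* v :+ a :* b :* j :- a :* a :* e) :* (x :* y)
                          :+ (a :* b :* e :+ a :* a :* d) :* (y :* y)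
      in  N a b b′ (:- a′) := N a′ b′ b (:- a)) refl u v j e d a b a′ b′

    module Family
      (inverse : Inverses)
      (G : ℕ → ℤ → Carrier) (D : ℕ → ℤ → Set)
      (D-pred : ∀ k m → D (suc k) m → D k m)
      (D-next : ∀ k m → D (2 ℕ.+ k) m → D (1 ℕ.+ k) (m ℤ.+ 1ℤ))
      (D-prev : ∀ k m → D (2 ℕ.+ k) m → D (1 ℕ.+ k) (m ℤ.- 1ℤ))
      (G-nonzero : ∀ k m → D k m → ¬ G k m ≈ 0#)
      (G-recurrence : ∀ k m → G (2 ℕ.+ k) m * G k m ≈ G (1 ℕ.+ k) (m ℤ.+ 1ℤ) * G (1 ℕ.+ k) (m ℤ.- 1ℤ))
      (u v j e d : Carrier)
      (Y⁺Y⁻ : ∀ m → D 2 m → G 0 (m ℤ.+ 1ℤ) * G 0 (m ℤ.- 1ℤ) ≈ ⟪ quadratic u v 0# ⟫ (G 1 m) (G 0 m))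
      (X⁺Y⁻+Y⁺X⁻ : ∀ m → D 2 m → G 1 (m ℤ.+ 1ℤ) * G 0 (m ℤ.- 1ℤ) + G 0 (m ℤ.+ 1ℤ) * G 1 (m ℤ.- 1ℤ)
                                 ≈ ⟪ quadratic (- v) j e ⟫ (G 1 m) (G 0 m))
      (X⁺X⁻ : ∀ m → D 2 m → G 1 (m ℤ.+ 1ℤ) * G 1 (m ℤ.- 1ℤ) ≈ ⟪ quadratic 0# (- e) d ⟫ (G 1 m) (G 0 m))
      where

      open Cancellation inverse

      private
        X Y : ℤ → Carrier
        X = G 1
        Y = G 0

        N : Linear → Quadratic
        N = shiftForm u v j e d

      shift-law : ∀ L {m} → D 2 m →
        ⟨ L ⟩ (X (m ℤ.+ 1ℤ)) (Y (m ℤ.+ 1ℤ)) * ⟨ L ⟩ (X (m ℤ.- 1ℤ)) (Y (m ℤ.- 1ℤ)) ≈ ⟪ N L ⟫ (X m) (Y m)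
      shift-law (a , b) {m} d₂ = begin
        (a * X⁺ + b * Y⁺) * (a * X⁻ + b * Y⁻)
          ≈⟨ solve 6 (λ a b X⁺ Y⁺ X⁻ Y⁻ → (a :* X⁺ :+ b :* Y⁺) :* (a :* X⁻ :+ b :* Y⁻)
                        := b :* b :* (Y⁺ :* Y⁻) :+ a :* b :* (X⁺ :* Y⁻ :+ Y⁺ :* X⁻) :+ a :* a :* (X⁺ :* X⁻))
                     refl a b X⁺ Y⁺ X⁻ Y⁻ ⟩
        b * b * (Y⁺ * Y⁻) + a * b * (X⁺ * Y⁻ + Y⁺ * X⁻) + a * a * (X⁺ * X⁻)
          ≈⟨ +-cong (+-cong (*-congˡ (Y⁺Y⁻ m d₂)) (*-congˡ (X⁺Y⁻+Y⁺X⁻ m d₂))) (*-congˡ (X⁺X⁻ m d₂)) ⟩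
        b * b * ⟪ quadratic u v 0# ⟫ x y + a * b * ⟪ quadratic (- v) j e ⟫ x y + a * a * ⟪ quadratic 0# (- e) d ⟫ x y
          ≈⟨ solve 9 (λ u v j e d a b x y →
               let Q = λ n₂ n₁ n₀ → n₂ :* (x :* x) :+ n₁ :* (x :* y) :+ n₀ :* (y :* y)
               in  b :* b :* Q u v (con (+ 0)) :+ a :* b :* Q (:- v) j e :+ a :* a :* Q (con (+ 0)) (:- e) d
                   := Q (b :* b :* u :- a :* b :* v) (b :* b :* v :+ a :* b :* j :- a :* a :* e) (a :* b :* e :+ a :* a :* d))
               refl u v j e d a b x y ⟩
        ⟪ N (a , b) ⟫ x y ∎
        where
        X⁺ Y⁺ X⁻ Y⁻ x y : Carrier
        X⁺ = X (m ℤ.+ 1ℤ)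
        Y⁺ = Y (m ℤ.+ 1ℤ)
        X⁻ = X (m ℤ.- 1ℤ)
        Y⁻ = Y (m ℤ.- 1ℤ)
        x = X m
        y = Y m

      -- compatible: the form of next (m + 1) · next (m − 1) vanishes at the root of this,
      -- so dividing it by this row is exact.
      record Consecutive (k : ℕ) : Set (c ⊔ ℓ) where
        field
          this next  : Linear
          this-row   : Row G D k this
          next-row   : Row G D (suc k) next
          compatible : N next atRootOf this ≈ 0#

      consecutive-base : Consecutive 0
      consecutive-base = record
        { this       = 0# , 1#
        ; next       = 1# , 0#
        ; this-row   = λ {m} _ → second-coordinate (X m) (Y m)
        ; next-row   = λ {m} _ → first-coordinate (X m) (Y m)
        ; compatible = solve 5 (λ u v j e d →
            let a = con (+ 1); b = con (+ 0); x = con (+ 1); y = :- con (+ 0)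
            in  (b :* b :* u :- a :* b :* v) :* (x :* x) :+ (b :* b :* v :+ a :* b :* j :- a :* a :* e) :* (x :* y)
                :+ (a :* b :* e :+ a :* a :* d) :* (y :* y) := con (+ 0)) refl u v j e d
        }

      D-two : ∀ k {m} → D (2 ℕ.+ k) m → D 2 m
      D-two zero    d = d
      D-two (suc k) d = D-two k (D-pred _ _ d)

      consecutive-step : ∀ {k m₀} → D (2 ℕ.+ k) m₀ → Consecutive k → Consecutive (suc k)
      consecutive-step {k} {m₀} d₀ record { this = L ; next = L′ ; this-row = row ; next-row = row′ ; compatible = root } =
        record { this = L′ ; next = P ; this-row = row′ ; next-row = row″ ; compatible = root′ }
        where
        dk₀ : D k m₀
        dk₀ = D-pred _ _ (D-pred _ _ d₀)
        w : Carrier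
        w = proj₁ (inverse (G k m₀) (G-nonzero _ _ dk₀))
        vw≈1 : ⟨ L ⟩ (X m₀) (Y m₀) * w ≈ 1#
        vw≈1 = trans (*-congʳ (sym (row dk₀))) (proj₂ (inverse (G k m₀) (G-nonzero _ _ dk₀)))
        P : Linear
        P = quotient (N L′) L (X m₀) (Y m₀) w
        factor : ∀ x y → ⟪ N L′ ⟫ x y ≈ ⟨ L ⟩ x y * ⟨ P ⟩ x y
        factor = factor-through-root (N L′) L root vw≈1
        row″ : Row G D (2 ℕ.+ k) P
        row″ {m} dm = *-cancelˡ-nonzero (G-nonzero _ _ dk) (begin
          G k m * G (2 ℕ.+ k) m                              ≈⟨ *-comm _ _ ⟩
          G (2 ℕ.+ k) m * G k m                              ≈⟨ G-recurrence k m ⟩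
          G (1 ℕ.+ k) (m ℤ.+ 1ℤ) * G (1 ℕ.+ k) (m ℤ.- 1ℤ)   ≈⟨ *-cong (row′ (D-next _ _ dm)) (row′ (D-prev _ _ dm)) ⟩
          ⟨ L′ ⟩ (X (m ℤ.+ 1ℤ)) (Y (m ℤ.+ 1ℤ)) * ⟨ L′ ⟩ (X (m ℤ.- 1ℤ)) (Y (m ℤ.- 1ℤ))
                                                             ≈⟨ shift-law L′ (D-two k dm) ⟩
          ⟪ N L′ ⟫ (X m) (Y m)                               ≈⟨ factor (X m) (Y m) ⟩
          ⟨ L ⟩ (X m) (Y m) * ⟨ P ⟩ (X m) (Y m)              ≈⟨ *-congʳ (row dk) ⟨
          G k m * ⟨ P ⟩ (X m) (Y m)                          ∎)
          where
          dk : D k m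
          dk = D-pred _ _ (D-pred _ _ dm)
        root′ : N P atRootOf L′ ≈ 0#
        root′ = begin
          N P atRootOf L′                                            ≈⟨ shiftForm-symmetric u v j e d P L′ ⟩
          N L′ atRootOf P                                            ≈⟨ factor _ _ ⟩
          ⟨ L ⟩ (proj₂ P) (- proj₁ P) * ⟨ P ⟩ (proj₂ P) (- proj₁ P)  ≈⟨ *-congˡ (linear-vanishes-at-root P) ⟩
          ⟨ L ⟩ (proj₂ P) (- proj₁ P) * 0#                           ≈⟨ zeroʳ _ ⟩
          0#                                                         ∎

      consecutive : ∀ k {m₀} → D (suc k) m₀ → Consecutive k
      consecutive zero    _  = consecutive-base
      consecutive (suc k) d₀ = consecutive-step d₀ (consecutive k (D-pred _ _ d₀))

      row-in-span : ∀ k {m₀} → D (2 ℕ.+ k) m₀ → Σ Linear (Row G D (2 ℕ.+ k))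
      row-in-span k d₀ = Consecutive.next (consecutive (suc k) d₀) , Consecutive.next-row (consecutive (suc k) d₀)

  module Somos4 (inverse : Inverses) (a₁ a₂ : Carrier) where

    open LinearCombination
    open Cancellation inverse

    Recurrence : (s₀ s₁ s₂ s₃ s₄ : Carrier) → Set ℓ
    Recurrence s₀ s₁ s₂ s₃ s₄ = s₀ * s₄ ≈ a₁ * (s₁ * s₃) + a₂ * (s₂ * s₂)

    Recurrence-cong : ∀ {s₀ s₁ s₂ s₃ s₄ t₁ t₂ t₃ t₄} →
                      s₁ ≈ t₁ → s₂ ≈ t₂ → s₃ ≈ t₃ → s₄ ≈ t₄ →
                      Recurrence s₀ s₁ s₂ s₃ s₄ → Recurrence s₀ t₁ t₂ t₃ t₄
    Recurrence-cong e₁ e₂ e₃ e₄ r =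
      trans (*-congˡ (sym e₄)) (trans r (+-cong (*-congˡ (*-cong e₁ e₃)) (*-congˡ (*-cong e₂ e₂))))

    numerator : (s₀ s₁ s₂ s₃ s₄ : Carrier) → Carrier
    numerator s₀ s₁ s₂ s₃ s₄ = s₄ * (s₁ * s₁) + s₃ * s₃ * s₀ + a₁ * (s₂ * s₂ * s₂)

    Invariant : (J s₀ s₁ s₂ s₃ s₄ : Carrier) → Set ℓ
    Invariant J s₀ s₁ s₂ s₃ s₄ = numerator s₀ s₁ s₂ s₃ s₄ ≈ J * (s₁ * s₂ * s₃)

    Invariant-cong : ∀ {J s₀ s₁ s₂ s₃ s₄ t₀ t₁ t₂ t₃ t₄} →
                     s₀ ≈ t₀ → s₁ ≈ t₁ → s₂ ≈ t₂ → s₃ ≈ t₃ → s₄ ≈ t₄ →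
                     Invariant J s₀ s₁ s₂ s₃ s₄ → Invariant J t₀ t₁ t₂ t₃ t₄
    Invariant-cong e₀ e₁ e₂ e₃ e₄ inv = trans
      (sym (+-cong (+-cong (*-cong e₄ (*-cong e₁ e₁)) (*-cong (*-cong e₃ e₃) e₀))
                   (*-congˡ (*-cong (*-cong e₂ e₂) e₂))))
      (trans inv (*-congˡ (*-cong (*-cong e₁ e₂) e₃)))

    numerator-shift : ∀ {s₀ s₁ s₂ s₃ s₄ s₅} → Recurrence s₀ s₁ s₂ s₃ s₄ → Recurrence s₁ s₂ s₃ s₄ s₅ →
                      s₁ * numerator s₁ s₂ s₃ s₄ s₅ ≈ s₄ * numerator s₀ s₁ s₂ s₃ s₄
    numerator-shift {s₀} {s₁} {s₂} {s₃} {s₄} {s₅} rec₀ rec₁ = combination₂ (s₂ * s₂) (- (s₃ * s₃))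
      (solve 8 (λ a₁ a₂ s₀ s₁ s₂ s₃ s₄ s₅ →
        let num = λ s₀ s₁ s₂ s₃ s₄ → s₄ :* (s₁ :* s₁) :+ s₃ :* s₃ :* s₀ :+ a₁ :* (s₂ :* s₂ :* s₂)
        in  s₁ :* num s₁ s₂ s₃ s₄ s₅ :- s₄ :* num s₀ s₁ s₂ s₃ s₄
            := s₂ :* s₂ :* (s₁ :* s₅ :- (a₁ :* (s₂ :* s₄) :+ a₂ :* (s₃ :* s₃)))
               :+ (:- (s₃ :* s₃)) :* (s₀ :* s₄ :- (a₁ :* (s₁ :* s₃) :+ a₂ :* (s₂ :* s₂))))
        refl a₁ a₂ s₀ s₁ s₂ s₃ s₄ s₅)
      rec₁ rec₀

    invariant-forward : ∀ {J s₀ s₁ s₂ s₃ s₄ s₅} → ¬ s₁ ≈ 0# →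
      Recurrence s₀ s₁ s₂ s₃ s₄ → Recurrence s₁ s₂ s₃ s₄ s₅ →
      Invariant J s₀ s₁ s₂ s₃ s₄ → Invariant J s₁ s₂ s₃ s₄ s₅
    invariant-forward {J} {s₀} {s₁} {s₂} {s₃} {s₄} {s₅} s₁≉0 rec₀ rec₁ inv = *-cancelˡ-nonzero s₁≉0 (begin
      s₁ * numerator s₁ s₂ s₃ s₄ s₅   ≈⟨ numerator-shift rec₀ rec₁ ⟩
      s₄ * numerator s₀ s₁ s₂ s₃ s₄   ≈⟨ *-congˡ inv ⟩
      s₄ * (J * (s₁ * s₂ * s₃))       ≈⟨ solve 5 (λ J s₁ s₂ s₃ s₄ → s₄ :* (J :* (s₁ :* s₂ :* s₃))
                                                                 := s₁ :* (J :* (s₂ :* s₃ :* s₄))) refl J s₁ s₂ s₃ s₄ ⟩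
      s₁ * (J * (s₂ * s₃ * s₄))       ∎)

    invariant-backward : ∀ {J s₀ s₁ s₂ s₃ s₄ s₅} → ¬ s₄ ≈ 0# →
      Recurrence s₀ s₁ s₂ s₃ s₄ → Recurrence s₁ s₂ s₃ s₄ s₅ →
      Invariant J s₁ s₂ s₃ s₄ s₅ → Invariant J s₀ s₁ s₂ s₃ s₄
    invariant-backward {J} {s₀} {s₁} {s₂} {s₃} {s₄} {s₅} s₄≉0 rec₀ rec₁ inv = *-cancelˡ-nonzero s₄≉0 (begin
      s₄ * numerator s₀ s₁ s₂ s₃ s₄   ≈⟨ numerator-shift rec₀ rec₁ ⟨
      s₁ * numerator s₁ s₂ s₃ s₄ s₅   ≈⟨ *-congˡ inv ⟩
      s₁ * (J * (s₂ * s₃ * s₄))       ≈⟨ solve 5 (λ J s₁ s₂ s₃ s₄ → s₁ :* (J :* (s₂ :* s₃ :* s₄))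
                                                                 := s₄ :* (J :* (s₁ :* s₂ :* s₃))) refl J s₁ s₂ s₃ s₄ ⟩
      s₄ * (J * (s₁ * s₂ * s₃))       ∎)

    -- Expand s₁ s₄ · s₀ s₅ = s₀ s₄ · s₁ s₅ by both recurrences and simplify with the invariant.
    somos5-relation : ∀ {J s₀ s₁ s₂ s₃ s₄ s₅} → ¬ s₁ * s₄ ≈ 0# →
      Recurrence s₀ s₁ s₂ s₃ s₄ → Recurrence s₁ s₂ s₃ s₄ s₅ → Invariant J s₀ s₁ s₂ s₃ s₄ →
      s₀ * s₅ ≈ (a₂ * J + a₁ * a₁) * (s₂ * s₃) - a₂ * (s₁ * s₄)
    somos5-relation {J} {s₀} {s₁} {s₂} {s₃} {s₄} {s₅} s₁s₄≉0 rec₀ rec₁ inv₀ = *-cancelˡ-nonzero s₁s₄≉0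
      (combination₃ (s₁ * s₅ - a₂ * (s₃ * s₃)) (a₁ * (s₁ * s₃) + a₂ * (s₂ * s₂)) (a₂ * s₄)
        (solve 9 (λ a₁ a₂ J s₀ s₁ s₂ s₃ s₄ s₅ →
          s₁ :* s₄ :* (s₀ :* s₅) :- s₁ :* s₄ :* ((a₂ :* J :+ a₁ :* a₁) :* (s₂ :* s₃) :- a₂ :* (s₁ :* s₄))
          := (s₁ :* s₅ :- a₂ :* (s₃ :* s₃)) :* (s₀ :* s₄ :- (a₁ :* (s₁ :* s₃) :+ a₂ :* (s₂ :* s₂)))
             :+ (a₁ :* (s₁ :* s₃) :+ a₂ :* (s₂ :* s₂)) :* (s₁ :* s₅ :- (a₁ :* (s₂ :* s₄) :+ a₂ :* (s₃ :* s₃)))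
             :+ a₂ :* s₄ :* (s₄ :* (s₁ :* s₁) :+ s₃ :* s₃ :* s₀ :+ a₁ :* (s₂ :* s₂ :* s₂) :- J :* (s₁ :* s₂ :* s₃)))
          refl a₁ a₂ J s₀ s₁ s₂ s₃ s₄ s₅)
        rec₀ rec₁ inv₀)

    even-Y⁺Y⁻ : ∀ s₁ s₂ s₃ → (s₃ * s₃) * (s₁ * s₁) ≈ ⟪ quadratic 1# 0# 0# ⟫ (s₃ * s₁) (s₂ * s₂)
    even-Y⁺Y⁻ = solve 3 (λ s₁ s₂ s₃ → (s₃ :* s₃) :* (s₁ :* s₁)
      := con (+ 1) :* ((s₃ :* s₁) :* (s₃ :* s₁)) :+ con (+ 0) :* ((s₃ :* s₁) :* (s₂ :* s₂))
         :+ con (+ 0) :* ((s₂ :* s₂) :* (s₂ :* s₂))) refl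

    even-X⁺Y⁻+Y⁺X⁻ : ∀ {J s₀ s₁ s₂ s₃ s₄} → Invariant J s₀ s₁ s₂ s₃ s₄ →
      (s₄ * s₂) * (s₁ * s₁) + (s₃ * s₃) * (s₂ * s₀) ≈ ⟪ quadratic (- 0#) J (- a₁) ⟫ (s₃ * s₁) (s₂ * s₂)
    even-X⁺Y⁻+Y⁺X⁻ {J} {s₀} {s₁} {s₂} {s₃} {s₄} = combination₁ s₂ (solve 7 (λ a₁ J s₀ s₁ s₂ s₃ s₄ →
      let x = s₃ :* s₁; y = s₂ :* s₂
      in  (s₄ :* s₂) :* (s₁ :* s₁) :+ (s₃ :* s₃) :* (s₂ :* s₀)
            :- ((:- con (+ 0)) :* (x :* x) :+ J :* (x :* y) :+ (:- a₁) :* (y :* y))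
          := s₂ :* (s₄ :* (s₁ :* s₁) :+ s₃ :* s₃ :* s₀ :+ a₁ :* (s₂ :* s₂ :* s₂) :- J :* (s₁ :* s₂ :* s₃)))
      refl a₁ J s₀ s₁ s₂ s₃ s₄)

    even-X⁺X⁻ : ∀ {s₀ s₁ s₂ s₃ s₄} → Recurrence s₀ s₁ s₂ s₃ s₄ →
      (s₄ * s₂) * (s₂ * s₀) ≈ ⟪ quadratic 0# (- (- a₁)) a₂ ⟫ (s₃ * s₁) (s₂ * s₂)
    even-X⁺X⁻ {s₀} {s₁} {s₂} {s₃} {s₄} = combination₁ (s₂ * s₂) (solve 7 (λ a₁ a₂ s₀ s₁ s₂ s₃ s₄ →
      let x = s₃ :* s₁; y = s₂ :* s₂
      in  (s₄ :* s₂) :* (s₂ :* s₀) :- (con (+ 0) :* (x :* x) :+ (:- (:- a₁)) :* (x :* y) :+ a₂ :* (y :* y))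
          := s₂ :* s₂ :* (s₀ :* s₄ :- (a₁ :* (s₁ :* s₃) :+ a₂ :* (s₂ :* s₂))))
      refl a₁ a₂ s₀ s₁ s₂ s₃ s₄)

    odd-Y⁺Y⁻ : ∀ s₁ s₂ s₃ s₄ → (s₄ * s₃) * (s₂ * s₁) ≈ ⟪ quadratic 0# 1# 0# ⟫ (s₄ * s₁) (s₃ * s₂)
    odd-Y⁺Y⁻ = solve 4 (λ s₁ s₂ s₃ s₄ → (s₄ :* s₃) :* (s₂ :* s₁)
      := con (+ 0) :* ((s₄ :* s₁) :* (s₄ :* s₁)) :+ con (+ 1) :* ((s₄ :* s₁) :* (s₃ :* s₂))
         :+ con (+ 0) :* ((s₃ :* s₂) :* (s₃ :* s₂))) refl

    odd-X⁺Y⁻+Y⁺X⁻ : ∀ {J s₀ s₁ s₂ s₃ s₄ s₅} →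
      Recurrence s₀ s₁ s₂ s₃ s₄ → Invariant J s₁ s₂ s₃ s₄ s₅ →
      (s₅ * s₂) * (s₂ * s₁) + (s₄ * s₃) * (s₃ * s₀) ≈ ⟪ quadratic (- 1#) J a₂ ⟫ (s₄ * s₁) (s₃ * s₂)
    odd-X⁺Y⁻+Y⁺X⁻ {J} {s₀} {s₁} {s₂} {s₃} {s₄} {s₅} rec₀ inv₁ =
      combination₂ s₁ (s₃ * s₃) (solve 9 (λ a₁ a₂ J s₀ s₁ s₂ s₃ s₄ s₅ →
        let x = s₄ :* s₁; y = s₃ :* s₂
        in  (s₅ :* s₂) :* (s₂ :* s₁) :+ (s₄ :* s₃) :* (s₃ :* s₀)
              :- ((:- con (+ 1)) :* (x :* x) :+ J :* (x :* y) :+ a₂ :* (y :* y))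
            := s₁ :* (s₅ :* (s₂ :* s₂) :+ s₄ :* s₄ :* s₁ :+ a₁ :* (s₃ :* s₃ :* s₃) :- J :* (s₂ :* s₃ :* s₄))
               :+ s₃ :* s₃ :* (s₀ :* s₄ :- (a₁ :* (s₁ :* s₃) :+ a₂ :* (s₂ :* s₂))))
        refl a₁ a₂ J s₀ s₁ s₂ s₃ s₄ s₅) inv₁ rec₀

    odd-X⁺X⁻ : ∀ {J s₀ s₁ s₂ s₃ s₄ s₅} →
      s₀ * s₅ ≈ (a₂ * J + a₁ * a₁) * (s₂ * s₃) - a₂ * (s₁ * s₄) →
      (s₅ * s₂) * (s₃ * s₀) ≈ ⟪ quadratic 0# (- a₂) (a₂ * J + a₁ * a₁) ⟫ (s₄ * s₁) (s₃ * s₂)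
    odd-X⁺X⁻ {J} {s₀} {s₁} {s₂} {s₃} {s₄} {s₅} = combination₁ (s₂ * s₃) (solve 9 (λ a₁ a₂ J s₀ s₁ s₂ s₃ s₄ s₅ →
      let x = s₄ :* s₁; y = s₃ :* s₂
      in  (s₅ :* s₂) :* (s₃ :* s₀)
            :- (con (+ 0) :* (x :* x) :+ (:- a₂) :* (x :* y) :+ (a₂ :* J :+ a₁ :* a₁) :* (y :* y))
          := s₂ :* s₃ :* (s₀ :* s₅ :- ((a₂ :* J :+ a₁ :* a₁) :* (s₂ :* s₃) :- a₂ :* (s₁ :* s₄))))
      refl a₁ a₂ J s₀ s₁ s₂ s₃ s₄ s₅)

  module Determinant where

    det3-cong : ∀ {M M′ : Fin 3 → Fin 3 → Carrier} → (∀ p q → M p q ≈ M′ p q) → det3 R M ≈ det3 R M′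
    det3-cong h =
      +-cong (+-cong (+-cong (*-cong (*-cong (h (# 0) (# 0)) (h (# 1) (# 1))) (h (# 2) (# 2)))
                             (*-cong (*-cong (h (# 0) (# 1)) (h (# 1) (# 2))) (h (# 2) (# 0))))
                     (*-cong (*-cong (h (# 0) (# 2)) (h (# 1) (# 0))) (h (# 2) (# 1))))
             (-‿cong (+-cong (+-cong (*-cong (*-cong (h (# 0) (# 2)) (h (# 1) (# 1))) (h (# 2) (# 0)))
                                     (*-cong (*-cong (h (# 0) (# 0)) (h (# 1) (# 2))) (h (# 2) (# 1))))
                             (*-cong (*-cong (h (# 0) (# 1)) (h (# 1) (# 0))) (h (# 2) (# 2)))))

    det3-rank-two : ∀ (A B X Y : Fin 3 → Carrier) → det3 R (λ p q → A p * X q + B p * Y q) ≈ 0#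
    det3-rank-two A B X Y = solve 12 (λ a₀ a₁ a₂ b₀ b₁ b₂ x₀ x₁ x₂ y₀ y₁ y₂ →
      let m₀ = λ x y → a₀ :* x :+ b₀ :* y
          m₁ = λ x y → a₁ :* x :+ b₁ :* y
          m₂ = λ x y → a₂ :* x :+ b₂ :* y
      in  (m₀ x₀ y₀ :* m₁ x₁ y₁ :* m₂ x₂ y₂ :+ m₀ x₁ y₁ :* m₁ x₂ y₂ :* m₂ x₀ y₀ :+ m₀ x₂ y₂ :* m₁ x₀ y₀ :* m₂ x₁ y₁)
          :- (m₀ x₂ y₂ :* m₁ x₁ y₁ :* m₂ x₀ y₀ :+ m₀ x₀ y₀ :* m₁ x₂ y₂ :* m₂ x₁ y₁ :+ m₀ x₁ y₁ :* m₁ x₀ y₀ :* m₂ x₂ y₂)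
          := con (+ 0))
      refl (A (# 0)) (A (# 1)) (A (# 2)) (B (# 0)) (B (# 1)) (B (# 2)) (X (# 0)) (X (# 1)) (X (# 2)) (Y (# 0)) (Y (# 1)) (Y (# 2))

    det3-of-rank-two : ∀ {M : Fin 3 → Fin 3 → Carrier} (A B X Y : Fin 3 → Carrier) →
                       (∀ p q → M p q ≈ A p * X q + B p * Y q) → det3 R M ≈ 0#
    det3-of-rank-two A B X Y M≈ = trans (det3-cong M≈) (det3-rank-two A B X Y)

private
  plus-difference : ∀ i j → i ℤ.+ (j ℤ.- i) ≡.≡ j
  plus-difference = ℤ-Solver.solve-∀

  minus-difference : ∀ i j → i ℤ.+ ℤ.- (i ℤ.- j) ≡.≡ j
  minus-difference = ℤ-Solver.solve-∀

module IntervalInduction {p q} (P : ℤ → Set p) (Q : ℤ → Set q)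
  (P-convex : ∀ {i j k} → i ℤ.≤ j → j ℤ.≤ k → P i → P k → P j)
  (step : ∀ k → P k → P (k ℤ.+ 1ℤ) → (Q k → Q (k ℤ.+ 1ℤ)) × (Q (k ℤ.+ 1ℤ) → Q k)) where

  along : ∀ n {m} → P m → P (m ℤ.+ + n) → (Q m → Q (m ℤ.+ + n)) × (Q (m ℤ.+ + n) → Q m)
  along zero    {m} _  _         = ≡.subst Q (≡.sym (ℤ.+-identityʳ m)) , ≡.subst Q (ℤ.+-identityʳ m)
  along (suc n) {m} Pm Pm+n+1 = forward , backward
    where
    m+n+1≡ : m ℤ.+ + n ℤ.+ 1ℤ ≡.≡ m ℤ.+ + suc n
    m+n+1≡ = ≡.trans (ℤ.+-assoc m (+ n) 1ℤ) (≡.cong (λ k → m ℤ.+ + k) (ℕ.+-comm n 1))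
    Pm+n : P (m ℤ.+ + n)
    Pm+n = P-convex (ℤ.i≤i+j m (+ n)) (ℤ.+-monoʳ-≤ m (ℤ.+≤+ (ℕ.n≤1+n n))) Pm Pm+n+1
    one-more : (Q (m ℤ.+ + n) → Q (m ℤ.+ + n ℤ.+ 1ℤ)) × (Q (m ℤ.+ + n ℤ.+ 1ℤ) → Q (m ℤ.+ + n))
    one-more = step _ Pm+n (≡.subst P (≡.sym m+n+1≡) Pm+n+1)
    forward : Q m → Q (m ℤ.+ + suc n)
    forward = ≡.subst Q m+n+1≡ ∘ proj₁ one-more ∘ proj₁ (along n Pm Pm+n)
    backward : Q (m ℤ.+ + suc n) → Q m
    backward = proj₂ (along n Pm Pm+n) ∘ proj₂ one-more ∘ ≡.subst Q (≡.sym m+n+1≡)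

  connected : ∀ {m₀ m} → P m₀ → P m → Q m₀ → Q m
  connected {m₀} {m} Pm₀ Pm with m ℤ.- m₀ in eq
  ... | + n      = ≡.subst Q m₀+n≡m ∘ proj₁ (along n Pm₀ (≡.subst P (≡.sym m₀+n≡m) Pm))
    where
    m₀+n≡m : m₀ ℤ.+ + n ≡.≡ m
    m₀+n≡m = ≡.trans (≡.cong (λ k → m₀ ℤ.+ k) (≡.sym eq)) (plus-difference m₀ m)
  ... | -[1+ n ] = proj₂ (along (suc n) Pm (≡.subst P (≡.sym m+n≡m₀) Pm₀)) ∘ ≡.subst Q (≡.sym m+n≡m₀)
    where
    m+n≡m₀ : m ℤ.+ + suc n ≡.≡ m₀
    m+n≡m₀ = ≡.trans (≡.cong (λ k → m ℤ.+ ℤ.- k) (≡.sym eq)) (minus-difference m m₀)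

private
  twice-difference : ∀ a b a′ b′ →
                     + 2 ℤ.* (a ℤ.- a′) ≡.≡ (a ℤ.- b) ℤ.- (a′ ℤ.- b′) ℤ.+ ((a ℤ.+ b) ℤ.- (a′ ℤ.+ b′))
  twice-difference = ℤ-Solver.solve-∀

  plus-zero-difference : ∀ a b → a ℤ.+ (b ℤ.- b) ≡.≡ a
  plus-zero-difference = ℤ-Solver.solve-∀

  from-first : ∀ a a₀ b₀ h → a ≡.≡ b₀ ℤ.+ h ℤ.+ ((a₀ ℤ.- b₀) ℤ.- h ℤ.* + 2 ℤ.+ (h ℤ.+ (a ℤ.- a₀)))
  from-first = ℤ-Solver.solve-∀

  cancel-double : ∀ x y z h → x ℤ.+ ((y ℤ.+ h ℤ.* + 2) ℤ.- h ℤ.* + 2 ℤ.+ z) ≡.≡ x ℤ.+ (y ℤ.+ z)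
  cancel-double = ℤ-Solver.solve-∀

  from-second : ∀ a b a₀ b₀ h → b ≡.≡ b₀ ℤ.+ h ℤ.- (h ℤ.+ (a ℤ.- a₀)) ℤ.+ ((a ℤ.+ b) ℤ.- (a₀ ℤ.+ b₀))
  from-second = ℤ-Solver.solve-∀

module DiamondGrid {P Q : Set} (p₀ : P) (q₀ : Q) (e′ : P → ℤ) (e″ : Q → ℤ) (pos : P → Q → ℤ × ℤ)
  (diagonal : ∀ p q → proj₁ (pos p q) ℤ.- proj₂ (pos p q) ≡.≡ e′ p)
  (antidiagonal : ∀ p q → proj₁ (pos p q) ℤ.+ proj₂ (pos p q) ≡.≡ e″ q) where

  open ≡.≡-Reasoning

  private
    i j : P → Q → ℤ
    i p q = proj₁ (pos p q)
    j p q = proj₂ (pos p q)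

    δ : P → ℤ
    δ p = i p q₀ ℤ.- i p₀ q₀

    h : ℤ
    h = e′ p₀ /ℕ 2

    twice-shift : ∀ p q → + 2 ℤ.* (i p q ℤ.- i p₀ q) ≡.≡ e′ p ℤ.- e′ p₀
    twice-shift p q = begin
      + 2 ℤ.* (i p q ℤ.- i p₀ q)
        ≡⟨ twice-difference (i p q) (j p q) (i p₀ q) (j p₀ q) ⟩
      (i p q ℤ.- j p q) ℤ.- (i p₀ q ℤ.- j p₀ q) ℤ.+ ((i p q ℤ.+ j p q) ℤ.- (i p₀ q ℤ.+ j p₀ q))
        ≡⟨ ≡.cong₂ ℤ._+_ (≡.cong₂ ℤ._-_ (diagonal p q) (diagonal p₀ q))
                         (≡.cong₂ ℤ._-_ (antidiagonal p q) (antidiagonal p₀ q)) ⟩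
      e′ p ℤ.- e′ p₀ ℤ.+ (e″ q ℤ.- e″ q)
        ≡⟨ plus-zero-difference (e′ p ℤ.- e′ p₀) (e″ q) ⟩
      e′ p ℤ.- e′ p₀ ∎

    shift : ∀ p q → i p q ℤ.- i p₀ q ≡.≡ δ p
    shift p q = ℤ.*-cancelˡ-≡ (+ 2) _ _ (≡.trans (twice-shift p q) (≡.sym (twice-shift p q₀)))

  t : ℕ
  t = e′ p₀ %ℕ 2

  t<2 : t ℕ.< 2
  t<2 = n%ℕd<d (e′ p₀) 2

  m : Q → ℤ
  m q = j p₀ q ℤ.+ h

  r : P → ℤ
  r p = h ℤ.+ δ p

  proj₁-pos : ∀ p q → proj₁ (pos p q) ≡.≡ m q ℤ.+ (+ t ℤ.+ r p)
  proj₁-pos p q = begin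
    i p q
      ≡⟨ from-first (i p q) (i p₀ q) (j p₀ q) h ⟩
    m q ℤ.+ ((i p₀ q ℤ.- j p₀ q) ℤ.- h ℤ.* + 2 ℤ.+ (h ℤ.+ (i p q ℤ.- i p₀ q)))
      ≡⟨ ≡.cong₂ (λ d x → m q ℤ.+ (d ℤ.- h ℤ.* + 2 ℤ.+ (h ℤ.+ x)))
                 (≡.trans (diagonal p₀ q) (a≡a%ℕn+[a/ℕn]*n (e′ p₀) 2)) (shift p q) ⟩
    m q ℤ.+ ((+ t ℤ.+ h ℤ.* + 2) ℤ.- h ℤ.* + 2 ℤ.+ r p)
      ≡⟨ cancel-double (m q) (+ t) (r p) h ⟩
    m q ℤ.+ (+ t ℤ.+ r p) ∎

  proj₂-pos : ∀ p q → proj₂ (pos p q) ≡.≡ m q ℤ.- r p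
  proj₂-pos p q = begin
    j p q
      ≡⟨ from-second (i p q) (j p q) (i p₀ q) (j p₀ q) h ⟩
    m q ℤ.- (h ℤ.+ (i p q ℤ.- i p₀ q)) ℤ.+ ((i p q ℤ.+ j p q) ℤ.- (i p₀ q ℤ.+ j p₀ q))
      ≡⟨ ≡.cong₂ (λ x y → m q ℤ.- (h ℤ.+ x) ℤ.+ y) (shift p q)
                 (≡.cong₂ ℤ._-_ (antidiagonal p q) (antidiagonal p₀ q)) ⟩
    m q ℤ.- r p ℤ.+ (e″ q ℤ.- e″ q)
      ≡⟨ plus-zero-difference (m q ℤ.- r p) (e″ q) ⟩
    m q ℤ.- r p ∎

private
  next-shrinks-left : ∀ m k → m ℤ.+ 1ℤ ℤ.- (1ℤ ℤ.+ k) ≡.≡ m ℤ.- k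
  next-shrinks-left = ℤ-Solver.solve-∀

  next-grows-right : ∀ m t k → m ℤ.+ 1ℤ ℤ.+ (t ℤ.+ (1ℤ ℤ.+ k)) ≡.≡ m ℤ.+ (t ℤ.+ (+ 2 ℤ.+ k))
  next-grows-right = ℤ-Solver.solve-∀

  previous-grows-left : ∀ m k → m ℤ.- 1ℤ ℤ.- (1ℤ ℤ.+ k) ≡.≡ m ℤ.- (+ 2 ℤ.+ k)
  previous-grows-left = ℤ-Solver.solve-∀

  previous-shrinks-right : ∀ m t k → m ℤ.- 1ℤ ℤ.+ (t ℤ.+ (1ℤ ℤ.+ k)) ≡.≡ m ℤ.+ (t ℤ.+ k)
  previous-shrinks-right = ℤ-Solver.solve-∀

module _ {c ℓ} (K : CommutativeRing c ℓ) where
  open CommutativeRing K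
  open IntegerCoefficients K
  open BinaryForms K
  open RowsInSpan K using (Row; module Family)
  open import Relation.Binary.Reasoning.Setoid setoid

  module SomosSequence
    (inverse : Inverses K)
    (I : ℤ → Set) (convex : IsIntInterval K I)
    (s : ℤ → Carrier) (s≉0 : ∀ i → I i → ¬ s i ≈ 0#)
    (a₁ a₂ : Carrier) (rec : SatisfiesRecurrence K I s a₁ a₂)
    where

    open Somos4 K inverse a₁ a₂
    open Cancellation K inverse

    Window : ℤ → ℤ → Set
    Window lo hi = ∀ {j} → lo ℤ.≤ j → j ℤ.≤ hi → I j

    window : ∀ {lo hi} → I lo → I hi → Window lo hi
    window Ilo Ihi lo≤j j≤hi = convex lo≤j j≤hi Ilo Ihi

    shrink : ∀ {lo hi lo′ hi′} → lo ℤ.≤ lo′ → hi′ ℤ.≤ hi → Window lo hi → Window lo′ hi′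
    shrink lo≤lo′ hi′≤hi w lo′≤j j≤hi′ = w (ℤ.≤-trans lo≤lo′ lo′≤j) (ℤ.≤-trans j≤hi′ hi′≤hi)

    offset-≤ : ∀ m {a b} {a≤b : True (a ℤ.≤? b)} → m ℤ.+ a ℤ.≤ m ℤ.+ b
    offset-≤ m {a≤b = a≤b} = ℤ.+-monoʳ-≤ m (toWitness a≤b)

    s-cong : ∀ {i j} → i ≡.≡ j → s i ≈ s j
    s-cong i≡j = reflexive (≡.cong s i≡j)

    s-assoc : ∀ m a b → s (m ℤ.+ a ℤ.+ b) ≈ s (m ℤ.+ (a ℤ.+ b))
    s-assoc m a b = s-cong (ℤ.+-assoc m a b)

    recurrence-from : ∀ m b → Window (m ℤ.+ b) (m ℤ.+ (b ℤ.+ + 4)) →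
      Recurrence (s (m ℤ.+ b)) (s (m ℤ.+ (b ℤ.+ + 1))) (s (m ℤ.+ (b ℤ.+ + 2))) (s (m ℤ.+ (b ℤ.+ + 3)))
                 (s (m ℤ.+ (b ℤ.+ + 4)))
    recurrence-from m b w = Recurrence-cong (s-assoc m b _) (s-assoc m b _) (s-assoc m b _) (s-assoc m b _)
      (rec (m ℤ.+ b) (λ j lo hi → w lo (ℤ.≤-trans hi (ℤ.≤-reflexive (ℤ.+-assoc m b (+ 4))))))

    Centred : ℤ → Set
    Centred m = Window (m ℤ.+ -[1+ 1 ]) (m ℤ.+ + 2)

    Centred-convex : ∀ {i j k} → i ℤ.≤ j → j ℤ.≤ k → Centred i → Centred k → Centred j
    Centred-convex {i} {j} {k} i≤j j≤k Pi Pk =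
      shrink (ℤ.+-monoˡ-≤ -[1+ 1 ] i≤j) (ℤ.+-monoˡ-≤ (+ 2) j≤k)
             (window (Pi ℤ.≤-refl (offset-≤ i)) (Pk (offset-≤ k) ℤ.≤-refl))

    Inv : Carrier → ℤ → Set ℓ
    Inv J m = Invariant J (s (m ℤ.+ -[1+ 1 ])) (s (m ℤ.+ -[1+ 0 ])) (s (m ℤ.+ + 0)) (s (m ℤ.+ + 1)) (s (m ℤ.+ + 2))

    Inv⁺ : Carrier → ℤ → Set ℓ
    Inv⁺ J m = Invariant J (s (m ℤ.+ -[1+ 0 ])) (s (m ℤ.+ + 0)) (s (m ℤ.+ + 1)) (s (m ℤ.+ + 2)) (s (m ℤ.+ + 3))

    Inv⁺⇔Inv : ∀ {J} m → (Inv⁺ J m → Inv J (m ℤ.+ 1ℤ)) × (Inv J (m ℤ.+ 1ℤ) → Inv⁺ J m)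
    Inv⁺⇔Inv m = Invariant-cong e e e e e , Invariant-cong (sym e) (sym e) (sym e) (sym e) (sym e)
      where
      e : ∀ {a} → s (m ℤ.+ (1ℤ ℤ.+ a)) ≈ s (m ℤ.+ 1ℤ ℤ.+ a)
      e {a} = sym (s-assoc m 1ℤ a)

    invariant-forward-at : ∀ {J} m → Window (m ℤ.+ -[1+ 1 ]) (m ℤ.+ + 3) → Inv J m → Inv⁺ J m
    invariant-forward-at m w = invariant-forward (s≉0 _ (w (offset-≤ m) (offset-≤ m)))
      (recurrence-from m -[1+ 1 ] (shrink ℤ.≤-refl (offset-≤ m) w))
      (recurrence-from m -[1+ 0 ] (shrink (offset-≤ m) ℤ.≤-refl w))

    invariant-backward-at : ∀ {J} m → Window (m ℤ.+ -[1+ 1 ]) (m ℤ.+ + 3) → Inv⁺ J m → Inv J m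
    invariant-backward-at m w = invariant-backward (s≉0 _ (w (offset-≤ m) (offset-≤ m)))
      (recurrence-from m -[1+ 1 ] (shrink ℤ.≤-refl (offset-≤ m) w))
      (recurrence-from m -[1+ 0 ] (shrink (offset-≤ m) ℤ.≤-refl w))

    Inv-step : ∀ {J} k → Centred k → Centred (k ℤ.+ 1ℤ) → (Inv J k → Inv J (k ℤ.+ 1ℤ)) × (Inv J (k ℤ.+ 1ℤ) → Inv J k)
    Inv-step k Pk Pk+1 = proj₁ (Inv⁺⇔Inv k) ∘ invariant-forward-at k w , invariant-backward-at k w ∘ proj₂ (Inv⁺⇔Inv k)
      where
      w : Window (k ℤ.+ -[1+ 1 ]) (k ℤ.+ + 3)
      w = window (Pk ℤ.≤-refl (offset-≤ k)) (≡.subst I (ℤ.+-assoc k 1ℤ (+ 2)) (Pk+1 (offset-≤ (k ℤ.+ 1ℤ)) ℤ.≤-refl))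

    invariant : ∀ m₀ → Centred m₀ → Σ Carrier λ J → ∀ m → Centred m → Inv J m
    invariant m₀ P₀ = J , λ m Pm →
      IntervalInduction.connected Centred (Inv J) Centred-convex Inv-step {m₀} {m} P₀ Pm Inv₀
      where
      product numerator₀ w J : Carrier
      product = s (m₀ ℤ.+ -[1+ 0 ]) * s (m₀ ℤ.+ + 0) * s (m₀ ℤ.+ + 1)
      numerator₀ = numerator (s (m₀ ℤ.+ -[1+ 1 ])) (s (m₀ ℤ.+ -[1+ 0 ])) (s (m₀ ℤ.+ + 0))
                             (s (m₀ ℤ.+ + 1)) (s (m₀ ℤ.+ + 2))
      product≉0 : ¬ product ≈ 0#
      product≉0 = *-nonzero (*-nonzero (s≉0 _ (P₀ (offset-≤ m₀) (offset-≤ m₀)))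
                                       (s≉0 _ (P₀ (offset-≤ m₀) (offset-≤ m₀))))
                            (s≉0 _ (P₀ (offset-≤ m₀) (offset-≤ m₀)))
      w = proj₁ (inverse product product≉0)
      J = numerator₀ * w
      Inv₀ : Inv J m₀
      Inv₀ = begin
        numerator₀                  ≈⟨ *-identityʳ numerator₀ ⟨
        numerator₀ * 1#             ≈⟨ *-congˡ (proj₂ (inverse product product≉0)) ⟨
        numerator₀ * (product * w)  ≈⟨ solve 3 (λ n p w → n :* (p :* w) := n :* w :* p) refl numerator₀ product w ⟩
        J * product                 ∎

    -- G t k m is the diamond entry on diagonal 2k + t and anti-diagonal 2m + t.
    G : ℕ → ℕ → ℤ → Carrier
    G t k m = s (m ℤ.+ + (t ℕ.+ k)) * s (m ℤ.- + k)

    D : ℕ → ℕ → ℤ → Set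
    D t k m = Window (m ℤ.- + k) (m ℤ.+ + (t ℕ.+ k))

    private
      minus-mono : ∀ m {k k′} → k ℕ.≤ k′ → m ℤ.- + k′ ℤ.≤ m ℤ.- + k
      minus-mono m k≤k′ = ℤ.+-monoʳ-≤ m (ℤ.neg-mono-≤ (ℤ.+≤+ k≤k′))

      plus-mono : ∀ m {k k′} → k ℕ.≤ k′ → m ℤ.+ + k ℤ.≤ m ℤ.+ + k′
      plus-mono m k≤k′ = ℤ.+-monoʳ-≤ m (ℤ.+≤+ k≤k′)

    D-pred : ∀ t k m → D t (suc k) m → D t k m
    D-pred t k m = shrink (minus-mono m (ℕ.n≤1+n k)) (plus-mono m (ℕ.+-monoʳ-≤ t (ℕ.n≤1+n k)))

    D-next : ∀ t k m → D t (2 ℕ.+ k) m → D t (1 ℕ.+ k) (m ℤ.+ 1ℤ)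
    D-next t k m = shrink
      (ℤ.≤-trans (minus-mono m (ℕ.m≤n+m k 2)) (ℤ.≤-reflexive (≡.sym (next-shrinks-left m (+ k)))))
      (ℤ.≤-reflexive (next-grows-right m (+ t) (+ k)))

    D-prev : ∀ t k m → D t (2 ℕ.+ k) m → D t (1 ℕ.+ k) (m ℤ.- 1ℤ)
    D-prev t k m = shrink
      (ℤ.≤-reflexive (≡.sym (previous-grows-left m (+ k))))
      (ℤ.≤-trans (ℤ.≤-reflexive (previous-shrinks-right m (+ t) (+ k))) (plus-mono m (ℕ.+-monoʳ-≤ t (ℕ.m≤n+m k 2))))

    D-centred : ∀ t k {m} → D t (2 ℕ.+ k) m → Centred m
    D-centred t k {m} = shrink (minus-mono m (ℕ.m≤m+n 2 k)) (plus-mono m (ℕ.≤-trans (ℕ.m≤m+n 2 k) (ℕ.m≤n+m (2 ℕ.+ k) t)))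

    G-nonzero : ∀ t k m → D t k m → ¬ G t k m ≈ 0#
    G-nonzero t k m w = *-nonzero (s≉0 _ (w lo≤hi ℤ.≤-refl)) (s≉0 _ (w ℤ.≤-refl lo≤hi))
      where
      lo≤hi : m ℤ.- + k ℤ.≤ m ℤ.+ + (t ℕ.+ k)
      lo≤hi = ℤ.+-monoʳ-≤ m ℤ.neg-≤-pos

    G-recurrence : ∀ t k m → G t (2 ℕ.+ k) m * G t k m ≈ G t (1 ℕ.+ k) (m ℤ.+ 1ℤ) * G t (1 ℕ.+ k) (m ℤ.- 1ℤ)
    G-recurrence t k m = begin
      (s (m ℤ.+ + (t ℕ.+ (2 ℕ.+ k))) * s (m ℤ.- + (2 ℕ.+ k))) * (s (m ℤ.+ + (t ℕ.+ k)) * s (m ℤ.- + k))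
        ≈⟨ solve 4 (λ a b c d → (a :* b) :* (c :* d) := (a :* d) :* (c :* b)) refl _ _ _ _ ⟩
      (s (m ℤ.+ + (t ℕ.+ (2 ℕ.+ k))) * s (m ℤ.- + k)) * (s (m ℤ.+ + (t ℕ.+ k)) * s (m ℤ.- + (2 ℕ.+ k)))
        ≈⟨ *-cong (*-cong (s-cong (next-grows-right m (+ t) (+ k))) (s-cong (next-shrinks-left m (+ k))))
                  (*-cong (s-cong (previous-shrinks-right m (+ t) (+ k))) (s-cong (previous-grows-left m (+ k)))) ⟨
      G t (1 ℕ.+ k) (m ℤ.+ 1ℤ) * G t (1 ℕ.+ k) (m ℤ.- 1ℤ) ∎

    G-around : ∀ t k m a → G t k (m ℤ.+ a) ≈ s (m ℤ.+ (a ℤ.+ + (t ℕ.+ k))) * s (m ℤ.+ (a ℤ.- + k))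
    G-around t k m a = *-cong (s-assoc m a _) (s-assoc m a _)

    module Even (m₀ : ℤ) (anchor : Centred m₀) where

      private
        J : Carrier
        J = proj₁ (invariant m₀ anchor)

        inv : ∀ m → Centred m → Inv J m
        inv = proj₂ (invariant m₀ anchor)

      Y⁺Y⁻ : ∀ m → D 0 2 m → G 0 0 (m ℤ.+ 1ℤ) * G 0 0 (m ℤ.- 1ℤ) ≈ ⟪ quadratic 1# 0# 0# ⟫ (G 0 1 m) (G 0 0 m)
      Y⁺Y⁻ m _ = trans (*-cong (G-around 0 0 m 1ℤ) (G-around 0 0 m -[1+ 0 ])) (even-Y⁺Y⁻ _ _ _)

      X⁺Y⁻+Y⁺X⁻ : ∀ m → D 0 2 m → G 0 1 (m ℤ.+ 1ℤ) * G 0 0 (m ℤ.- 1ℤ) + G 0 0 (m ℤ.+ 1ℤ) * G 0 1 (m ℤ.- 1ℤ)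
                                  ≈ ⟪ quadratic (- 0#) J (- a₁) ⟫ (G 0 1 m) (G 0 0 m)
      X⁺Y⁻+Y⁺X⁻ m d = trans (+-cong (*-cong (G-around 0 1 m 1ℤ) (G-around 0 0 m -[1+ 0 ]))
                                    (*-cong (G-around 0 0 m 1ℤ) (G-around 0 1 m -[1+ 0 ])))
                            (even-X⁺Y⁻+Y⁺X⁻ (inv m d))

      X⁺X⁻ : ∀ m → D 0 2 m → G 0 1 (m ℤ.+ 1ℤ) * G 0 1 (m ℤ.- 1ℤ) ≈ ⟪ quadratic 0# (- (- a₁)) a₂ ⟫ (G 0 1 m) (G 0 0 m)
      X⁺X⁻ m d = trans (*-cong (G-around 0 1 m 1ℤ) (G-around 0 1 m -[1+ 0 ])) (even-X⁺X⁻ (recurrence-from m -[1+ 1 ] d))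

      open Family inverse (G 0) (D 0) (D-pred 0) (D-next 0) (D-prev 0) (G-nonzero 0) (G-recurrence 0)
                  1# 0# J (- a₁) a₂ Y⁺Y⁻ X⁺Y⁻+Y⁺X⁻ X⁺X⁻ public
        using (row-in-span)

    module Odd (m₀ : ℤ) (anchor : Centred m₀) where

      private
        J : Carrier
        J = proj₁ (invariant m₀ anchor)

        inv : ∀ m → Centred m → Inv J m
        inv = proj₂ (invariant m₀ anchor)

        left-half : ∀ m → D 1 2 m → Centred m
        left-half m = shrink ℤ.≤-refl (offset-≤ m)

        right-half : ∀ m → D 1 2 m → Window (m ℤ.+ -[1+ 0 ]) (m ℤ.+ + 3)
        right-half m = shrink (offset-≤ m) ℤ.≤-refl

      Y⁺Y⁻ : ∀ m → D 1 2 m → G 1 0 (m ℤ.+ 1ℤ) * G 1 0 (m ℤ.- 1ℤ) ≈ ⟪ quadratic 0# 1# 0# ⟫ (G 1 1 m) (G 1 0 m)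
      Y⁺Y⁻ m _ = trans (*-cong (G-around 1 0 m 1ℤ) (G-around 1 0 m -[1+ 0 ])) (odd-Y⁺Y⁻ _ _ _ _)

      X⁺Y⁻+Y⁺X⁻ : ∀ m → D 1 2 m → G 1 1 (m ℤ.+ 1ℤ) * G 1 0 (m ℤ.- 1ℤ) + G 1 0 (m ℤ.+ 1ℤ) * G 1 1 (m ℤ.- 1ℤ)
                                  ≈ ⟪ quadratic (- 1#) J a₂ ⟫ (G 1 1 m) (G 1 0 m)
      X⁺Y⁻+Y⁺X⁻ m d = trans (+-cong (*-cong (G-around 1 1 m 1ℤ) (G-around 1 0 m -[1+ 0 ]))
                                    (*-cong (G-around 1 0 m 1ℤ) (G-around 1 1 m -[1+ 0 ])))
                            (odd-X⁺Y⁻+Y⁺X⁻ (recurrence-from m -[1+ 1 ] (left-half m d))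
                                           (invariant-forward-at m d (inv m (left-half m d))))

      X⁺X⁻ : ∀ m → D 1 2 m → G 1 1 (m ℤ.+ 1ℤ) * G 1 1 (m ℤ.- 1ℤ)
                             ≈ ⟪ quadratic 0# (- a₂) (a₂ * J + a₁ * a₁) ⟫ (G 1 1 m) (G 1 0 m)
      X⁺X⁻ m d = trans (*-cong (G-around 1 1 m 1ℤ) (G-around 1 1 m -[1+ 0 ]))
                       (odd-X⁺X⁻ (somos5-relation (*-nonzero (s≉0 _ (d (offset-≤ m) (offset-≤ m)))
                                                             (s≉0 _ (d (offset-≤ m) (offset-≤ m))))
                                                  (recurrence-from m -[1+ 1 ] (left-half m d))
                                                  (recurrence-from m -[1+ 0 ] (right-half m d))
                                                  (inv m (left-half m d))))

      open Family inverse (G 1) (D 1) (D-pred 1) (D-next 1) (D-prev 1) (G-nonzero 1) (G-recurrence 1)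
                  0# 1# J a₂ (a₂ * J + a₁ * a₁) Y⁺Y⁻ X⁺Y⁻+Y⁺X⁻ X⁺X⁻ public
        using (row-in-span)

    rows : ∀ t → t ℕ.< 2 → ∀ k {m₀} → D t k m₀ → Σ Linear (Row (G t) (D t) k)
    rows t _ 0 _ = (0# , 1#) , λ {m} _ → second-coordinate (G t 1 m) (G t 0 m)
    rows t _ 1 _ = (1# , 0#) , λ {m} _ → first-coordinate (G t 1 m) (G t 0 m)
    rows 0 _ (suc (suc k)) {m₀} d₀ = Even.row-in-span m₀ (D-centred 0 k {m₀} d₀) k {m₀} d₀
    rows 1 _ (suc (suc k)) {m₀} d₀ = Odd.row-in-span m₀ (D-centred 1 k {m₀} d₀) k {m₀} d₀
    rows (suc (suc _)) (ℕ.s≤s (ℕ.s≤s ())) _ _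

    RowOfEntries : ℕ → ℤ → Linear → Set ℓ
    RowOfEntries t r L = ∀ {m} → I (m ℤ.+ (+ t ℤ.+ r)) → I (m ℤ.- r) →
                         s (m ℤ.+ (+ t ℤ.+ r)) * s (m ℤ.- r) ≈ ⟨ L ⟩ (G t 1 m) (G t 0 m)

    -- For r < 0 the entry is G t k m read backwards, with k = - r - t.
    entry-rows : ∀ t → t ℕ.< 2 → ∀ r {m₀} → I (m₀ ℤ.+ (+ t ℤ.+ r)) → I (m₀ ℤ.- r) → Σ Linear (RowOfEntries t r)
    entry-rows t t<2 (+ k) {m₀} I₁ I₂ =
      map₂ (λ row {m} I₁ I₂ → row {m} (window I₂ I₁)) (rows t t<2 k {m₀} (window I₂ I₁))
    entry-rows 0 t<2 -[1+ n ] {m₀} I₁ I₂ =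
      map₂ (λ row {m} I₁ I₂ → trans (*-comm _ _) (row {m} (window I₁ I₂))) (rows 0 t<2 (suc n) {m₀} (window I₁ I₂))
    entry-rows 1 t<2 -[1+ 0 ] {m₀} I₁ I₂ =
      map₂ (λ row {m} I₁ I₂ → trans (*-comm _ _) (row {m} (window I₁ I₂))) (rows 1 t<2 0 {m₀} (window I₁ I₂))
    entry-rows 1 t<2 -[1+ suc n ] {m₀} I₁ I₂ =
      map₂ (λ row {m} I₁ I₂ → trans (*-comm _ _) (row {m} (window I₁ I₂))) (rows 1 t<2 (suc n) {m₀} (window I₁ I₂))
    entry-rows (suc (suc _)) (ℕ.s≤s (ℕ.s≤s ())) _ _ _

-- The offsets e′ and e″ need not be distinct for the argument.
theorem9p3 : ∀ {c ℓ : Level} (K : CommutativeRing c ℓ) → IsACF₀ K →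
    (I : ℤ → Set) → IsIntInterval K I →
    (s : ℤ → CommutativeRing.Carrier K) →
    (∀ i → I i → ¬ (CommutativeRing._≈_ K (s i) (CommutativeRing.0# K))) →
    (a₁ a₂ : CommutativeRing.Carrier K) →
    SatisfiesRecurrence K I s a₁ a₂ →
    DiamondRankAtMost2 K I s s
theorem9p3 K acf I convex s s≉0 a₁ a₂ rec e′ e″ _ _ pos meet =
  det3-of-rank-two (proj₁ ∘ L) (proj₂ ∘ L) (λ q → G t 1 (m q)) (λ q → G t 0 (m q)) entry
  where
  open CommutativeRing K
  open BinaryForms K using (Linear)
  open Determinant K
  open DiamondGrid (# 0) (# 0) e′ e″ pos (λ p q → proj₁ (meet p q)) (λ p q → proj₁ (proj₂ (meet p q)))
  open SomosSequence K (IsACF₀.inverse acf) I convex s s≉0 a₁ a₂ rec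

  I-first : ∀ p q → I (m q ℤ.+ (+ t ℤ.+ r p))
  I-first p q = ≡.subst I (proj₁-pos p q) (proj₁ (proj₂ (proj₂ (meet p q))))

  I-second : ∀ p q → I (m q ℤ.- r p)
  I-second p q = ≡.subst I (proj₂-pos p q) (proj₂ (proj₂ (proj₂ (meet p q))))

  row : (p : Fin 3) → Σ Linear (RowOfEntries t (r p))
  row p = entry-rows t t<2 (r p) {m (# 0)} (I-first p (# 0)) (I-second p (# 0))

  L : Fin 3 → Linear
  L = proj₁ ∘ row

  entry : ∀ p q → outer K s s (pos p q) ≈ proj₁ (L p) * G t 1 (m q) + proj₂ (L p) * G t 0 (m q)
  entry p q = trans (*-cong (reflexive (≡.cong s (proj₁-pos p q))) (reflexive (≡.cong s (proj₂-pos p q))))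
                    (proj₂ (row p) {m q} (I-first p q) (I-second p q))
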